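{- Let $A$ be a justified AJM game and $\phi,\psi$ skeletons (in the general sense) on $A$. Then $\phi\sqsubseteq_{\approx}\psi$ if and only if $\phi^\bullet\subseteq\psi^\bullet$.
   Context: A justified AJM game $A=(M_A,\lambda_A,\mathsf{j}_A,P_A,\approx_A)$: set of moves; labelling $\lambda_A:M_A\to\{P,O\}\times\{Q,A\}$; a partial justification function (well-founded; P-moves justified by O-moves and vice versa; answers justified by questions); a non-empty prefix-closed set $P_A$ of finite move sequences (plays) which start with an O-move, alternate O/P, contain each move at most once, are prefixes of well-bracketed strings, and contain the justifier of each move earlier; an equivalence $\approx_A$ on $P_A$ such that (e1) $s\approx_A t$ implies equal label sequences, (e2) equal-length prefixes of equivalent plays are equivalent, (e3) $s\approx_A t$, $sa\in P_A$ imply $sa\approx_A tb$ for some $b$. A skeleton (general sense): a non-empty set $\phi$ of even-length plays, causally consistent ($sab\in\phi\Rightarrow s\in\phi$), satisfying Functional Determinacy ($sab,sac\in\phi\Rightarrow b=c$) and Functional Representation Independence (if $sab\in\phi$, $t\in\phi$, $sa\approx_A ta'$ then there is a unique $b'$ with $ta'b'\in\phi$ and $sab\approx_A ta'b'$). $\phi^\bullet=\{t\mid\exists s\in\phi.\ s\approx_A t\}$. Preorder: $\phi\sqsubseteq_{\approx}\psi$ iff whenever $sab\in\phi$, $s'\in\psi$ and $sa\approx_A s'a'$, there exists $b'$ with $s'a'b'\in\psi$ and $sab\approx_A s'a'b'$. -}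

module Defs where

open import Data.Nat using (ℕ; zero; suc)
open import Data.List using (List; []; _∷_; _++_; _∷ʳ_; length; map)
open import Data.List.Membership.Propositional using (_∈_)
open import Data.List.Relation.Unary.Unique.Propositional using (Unique)
open import Data.Maybe using (Maybe; just; nothing)
open import Data.Product using (Σ; ∃; ∃-syntax; _×_; _,_)
open import Data.Empty using (⊥)
open import Relation.Nullary using (¬_)
open import Relation.Binary.PropositionalEquality using (_≡_; _≢_)
open import Induction.WellFounded using (WellFounded)

data Pol : Set where
  P O : Pol

data QA : Set where
  Q A : QA

data Even : ℕ → Set where
  ezero : Even zero
  esuc  : ∀ {n} → Even n → Even (suc (suc n))

module _ {M : Set} (pol : M → Pol) where
  StartsOAlternates : List M → Set
  StartsOAlternates s = ∀ u m w → s ≡ u ++ (m ∷ w) →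
    (Even (length u) → pol m ≡ O) × (¬ Even (length u) → pol m ≡ P)

-- "n justifies m"  (as a relation with n on the left, for well-foundedness)
module _ {M : Set} (j : M → Maybe M) where
  Justifies : M → M → Set
  Justifies n m = j m ≡ just n

  JustifiersEarlier : List M → Set
  JustifiersEarlier s = ∀ u m w n → s ≡ u ++ (m ∷ w) → j m ≡ just n → n ∈ u

module _ {M : Set} (qa : M → QA) (j : M → Maybe M) where
  WellBracketed : List M → Set
  WellBracketed s = ∀ u q v a w → s ≡ u ++ (q ∷ (v ++ (a ∷ w))) →
    qa a ≡ A → j a ≡ just q →
    ∀ v₁ q' v₂ → v ≡ v₁ ++ (q' ∷ v₂) → qa q' ≡ Q →
    ∃[ a' ] (a' ∈ v₂ × qa a' ≡ A × j a' ≡ just q')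

  PrefixOfWellBracketed : List M → Set
  PrefixOfWellBracketed s = ∃[ r ] WellBracketed (s ++ r)


Prefix : {M : Set} → List M → List M → Set
Prefix s' s = ∃[ r ] (s' ++ r ≡ s)

record Game : Set₁ where
  field
    Move  : Set
    pol   : Move → Pol
    qa    : Move → QA
    jst   : Move → Maybe Move
    jst-wf : WellFounded (Justifies jst)
    jst-pol : ∀ m n → jst m ≡ just n → pol m ≢ pol n
    jst-qa  : ∀ m n → jst m ≡ just n → qa m ≡ A → qa n ≡ Q
    Play : List Move → Set
    play-nonempty : ∃[ s ] Play s
    play-prefix   : ∀ s t → Play (s ++ t) → Play s
    play-alt      : ∀ s → Play s → StartsOAlternates pol s
    play-unique   : ∀ s → Play s → Unique s
    play-wb       : ∀ s → Play s → PrefixOfWellBracketed {M = Move} qa jst s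
    play-just     : ∀ s → Play s → JustifiersEarlier jst s
    _≈_ : List Move → List Move → Set
    ≈-plays : ∀ s t → s ≈ t → Play s × Play t
    ≈-refl  : ∀ s → Play s → s ≈ s
    ≈-sym   : ∀ s t → s ≈ t → t ≈ s
    ≈-trans : ∀ s t u → s ≈ t → t ≈ u → s ≈ u
    e1 : ∀ s t → s ≈ t →
      map (λ m → (pol m , qa m)) s ≡ map (λ m → (pol m , qa m)) t
    e2 : ∀ s t s' t' → s ≈ t → Prefix s' s → Prefix t' t →
      length s' ≡ length t' → s' ≈ t'
    e3 : ∀ s t a → s ≈ t → Play (s ∷ʳ a) → ∃[ b ] ((s ∷ʳ a) ≈ (t ∷ʳ b))

module _ (G : Game) where
  open Game G

  record Skeleton : Set₁ where
    field
      Φ : List Move → Set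
      nonempty : ∃[ s ] Φ s
      plays    : ∀ s → Φ s → Play s
      even     : ∀ s → Φ s → Even (length s)
      causal   : ∀ s a b → Φ (s ∷ʳ a ∷ʳ b) → Φ s
      fd  : ∀ s a b c → Φ (s ∷ʳ a ∷ʳ b) → Φ (s ∷ʳ a ∷ʳ c) → b ≡ c
      fri : ∀ s a b t a' → Φ (s ∷ʳ a ∷ʳ b) → Φ t → (s ∷ʳ a) ≈ (t ∷ʳ a') →
        Σ Move λ b' → (Φ (t ∷ʳ a' ∷ʳ b') × ((s ∷ʳ a ∷ʳ b) ≈ (t ∷ʳ a' ∷ʳ b')))
          × (∀ b'' → Φ (t ∷ʳ a' ∷ʳ b'') → (s ∷ʳ a ∷ʳ b) ≈ (t ∷ʳ a' ∷ʳ b'') → b'' ≡ b')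

  open Skeleton

  _• : Skeleton → List Move → Set
  (φ •) t = ∃[ s ] (Φ φ s × s ≈ t)

  _⊆•_ : Skeleton → Skeleton → Set
  φ ⊆• ψ = ∀ t → (φ •) t → (ψ •) t

  _⊑≈_ : Skeleton → Skeleton → Set
  φ ⊑≈ ψ = ∀ s a b s' a' → Φ φ (s ∷ʳ a ∷ʳ b) → Φ ψ s' → (s ∷ʳ a) ≈ (s' ∷ʳ a') →
    ∃[ b' ] (Φ ψ (s' ∷ʳ a' ∷ʳ b') × ((s ∷ʳ a ∷ʳ b) ≈ (s' ∷ʳ a' ∷ʳ b')))

module Submission where

-- (⇒) By induction on even-length plays, φ ⊑≈ ψ shows that every play of φ
-- is equivalent to a play of ψ (φ ⊆ ψ•): the empty play lies in every
-- skeleton, and a play s a b of φ is simulated by extending the simulating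
-- play s' of s with a' given by (e3) and b' given by φ ⊑≈ ψ.  Since ψ• is
-- closed under ≈, φ• ⊆ ψ• follows.
-- (⇐) Given s a b ∈ φ and s' ∈ ψ with s a ≈ s' a', the inclusion yields a
-- play u c d ∈ ψ equivalent to s a b; by (e2) u c ≈ s a ≈ s' a', and
-- Functional Representation Independence of ψ produces the answer b'.

open import Defs
open import Function.Bundles using (_⇔_; mk⇔)
open import Data.Nat using (ℕ; zero; suc)
open import Data.Nat.Properties using (suc-injective; +-comm)
open import Data.List using (List; []; _∷_; _∷ʳ_; length; initLast; _∷ʳ′_)
open import Data.List.Properties using (length-map; length-++)
open import Data.Product using (∃-syntax; _×_; _,_)
open import Relation.Binary.PropositionalEquality using (_≡_; refl; sym; trans; cong)

length-∷ʳ : ∀ {M : Set} (s : List M) (a : M) → length (s ∷ʳ a) ≡ suc (length s)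
length-∷ʳ s a = trans (length-++ s) (+-comm (length s) 1)

unsnoc₂ : ∀ {M : Set} (s : List M) (n : ℕ) → length s ≡ suc (suc n) →
  ∃[ s₀ ] ∃[ a ] ∃[ b ] (s ≡ s₀ ∷ʳ a ∷ʳ b × length s₀ ≡ n)
unsnoc₂ s n len with initLast s
... | [] with () ← len
... | s₁ ∷ʳ′ b with initLast s₁
...   | [] with () ← suc-injective (trans (sym (length-∷ʳ [] b)) len)
...   | s₀ ∷ʳ′ a = s₀ , a , b , refl , len₀
  where
  len₀ : length s₀ ≡ n
  len₀ = suc-injective (suc-injective
    (trans (sym (trans (length-∷ʳ (s₀ ∷ʳ a) b) (cong suc (length-∷ʳ s₀ a)))) len))

even-induction : ∀ {M : Set} (Inv : List M → Set) → Inv [] →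
  (∀ s a b → Inv s → Inv (s ∷ʳ a ∷ʳ b)) →
  ∀ s → Even (length s) → Inv s
even-induction Inv base step s = go (length s) s refl
  where
  go : ∀ n s → length s ≡ n → Even n → Inv s
  go zero [] _ _ = base
  go (suc (suc n)) s len (esuc ev) with unsnoc₂ s n len
  ... | s₀ , a , b , refl , len₀ = step s₀ a b (go n s₀ len₀ ev)

module _ (G : Game) where
  open Game G
  open Skeleton

  ≈-length : ∀ s t → s ≈ t → length s ≡ length t
  ≈-length s t s≈t =
    trans (sym (length-map _ s)) (trans (cong length (e1 s t s≈t)) (length-map _ t))

  ≈-init : ∀ s a t b → (s ∷ʳ a) ≈ (t ∷ʳ b) → s ≈ t
  ≈-init s a t b sa≈tb = e2 _ _ s t sa≈tb (a ∷ [] , refl) (b ∷ [] , refl)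
    (suc-injective (trans (sym (length-∷ʳ s a)) (trans (≈-length _ _ sa≈tb) (length-∷ʳ t b))))

  ≈-unsnoc₂ : ∀ u s a b → u ≈ (s ∷ʳ a ∷ʳ b) → ∃[ u₀ ] ∃[ c ] ∃[ d ] (u ≡ u₀ ∷ʳ c ∷ʳ d)
  ≈-unsnoc₂ u s a b u≈sab with unsnoc₂ u (length s)
    (trans (≈-length _ _ u≈sab) (trans (length-∷ʳ (s ∷ʳ a) b) (cong suc (length-∷ʳ s a))))
  ... | u₀ , c , d , u≡ucd , _ = u₀ , c , d , u≡ucd

  []∈Φ : (ψ : Skeleton G) → Φ ψ []
  []∈Φ ψ with nonempty ψ
  ... | s , s∈ψ =
    even-induction (λ s → Φ ψ s → Φ ψ []) (λ []∈ψ → []∈ψ)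
      (λ s a b ih sab∈ψ → ih (causal ψ s a b sab∈ψ)) s (even ψ s s∈ψ) s∈ψ

  •-≈-closed : (ψ : Skeleton G) → ∀ t u → _• G ψ t → t ≈ u → _• G ψ u
  •-≈-closed ψ t u (s , s∈ψ , s≈t) t≈u = s , s∈ψ , ≈-trans s t u s≈t t≈u

  ⊑≈⇒⊆• : (φ ψ : Skeleton G) → _⊑≈_ G φ ψ → ∀ s → Φ φ s → _• G ψ s
  ⊑≈⇒⊆• φ ψ φ⊑ψ s s∈φ =
    even-induction (λ s → Φ φ s → _• G ψ s) base step s (even φ s s∈φ) s∈φ
    where
    base : Φ φ [] → _• G ψ []
    base []∈φ = [] , []∈Φ ψ , ≈-refl [] (plays φ [] []∈φ)

    step : ∀ s a b → (Φ φ s → _• G ψ s) → Φ φ (s ∷ʳ a ∷ʳ b) → _• G ψ (s ∷ʳ a ∷ʳ b)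
    step s a b ih sab∈φ with ih (causal φ s a b sab∈φ)
    ... | s' , s'∈ψ , s'≈s
      with e3 s s' a (≈-sym s' s s'≈s) (play-prefix (s ∷ʳ a) (b ∷ []) (plays φ _ sab∈φ))
    ... | a' , sa≈s'a' with φ⊑ψ s a b s' a' sab∈φ s'∈ψ sa≈s'a'
    ... | b' , s'a'b'∈ψ , sab≈s'a'b' = _ , s'a'b'∈ψ , ≈-sym _ _ sab≈s'a'b'

  ⊑≈⇒•⊆• : (φ ψ : Skeleton G) → _⊑≈_ G φ ψ → _⊆•_ G φ ψ
  ⊑≈⇒•⊆• φ ψ φ⊑ψ t (s , s∈φ , s≈t) = •-≈-closed ψ s t (⊑≈⇒⊆• φ ψ φ⊑ψ s s∈φ) s≈t

  •⊆•⇒⊑≈ : (φ ψ : Skeleton G) → _⊆•_ G φ ψ → _⊑≈_ G φ ψ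
  •⊆•⇒⊑≈ φ ψ φ•⊆ψ• s a b s' a' sab∈φ s'∈ψ sa≈s'a'
    with φ•⊆ψ• _ (_ , sab∈φ , ≈-refl _ (plays φ _ sab∈φ))
  ... | u , u∈ψ , u≈sab with ≈-unsnoc₂ u s a b u≈sab
  ... | u₀ , c , d , refl
    with fri ψ u₀ c d s' a' u∈ψ s'∈ψ (≈-trans _ _ _ (≈-init _ d _ b u≈sab) sa≈s'a')
  ... | b' , (s'a'b'∈ψ , ucd≈s'a'b') , _ =
    b' , s'a'b'∈ψ , ≈-trans _ _ _ (≈-sym _ _ u≈sab) ucd≈s'a'b'

mainTheorem15 : (G : Game) → (φ ψ : Skeleton G) → (_⊑≈_ G φ ψ) ⇔ (_⊆•_ G φ ψ)
mainTheorem15 G φ ψ = mk⇔ (⊑≈⇒•⊆• G φ ψ) (•⊆•⇒⊑≈ G φ ψ)
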